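{- Let $q\ge2$ be a prime power and let $n,k,t,s$ be positive integers with $k\ge t+2$ and $n\ge 3k+3t+1+\log_q(13s)$. Define for integers $x$ $$f_2(n,k,t,s,x)={x-t\brack 1}{n-t-1\brack k-t-1}+q^{2(x-t)}{k+1-x\brack 1}^2{n-t-2\brack k-t-2}+2s,$$ and let $$g_1(n,k,t,s)=\left({n-t\brack k-t}-q^{(k-t)(k+1-t)}{n-k-1\brack k-t}+s\right)\left({n-t\brack k-t}+\min\{s,q^{k-t+1}{t\brack 1}\}\right).$$ Then (i) $f_2(n,k,t,s,x)$ is increasing as $x\in\{t+1,t+2,\dots,k-1\}$ increases; and (ii) $$f_2(n,k,t,s,k)\left({n-t\brack k-t}+q^2{k-t\brack 1}{t\brack 1}{n-t-1\brack k-t-1}+s\right)<g_1(n,k,t,s).$$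
   Context: Gaussian binomial: ${a\brack b}=\prod_{0\le i<b}\frac{q^{a-i}-1}{q^{b-i}-1}$ for positive integers $a,b$, ${a\brack 0}=1$, ${a\brack b}=0$ for $b<0$. -}

module Defs where

open import Data.Nat using (ℕ; zero; suc; _+_; _*_; _∸_; _^_; _≤_; _⊓_)
open import Data.Nat.DivMod using (_/_)
open import Data.Nat.Primality using (Prime)
open import Data.Product using (Σ; _×_)
open import Data.Integer as ℤ using (ℤ; +_)
open import Relation.Binary.PropositionalEquality using (_≡_)

IsPrimePower : ℕ → Set
IsPrimePower q = Σ ℕ λ p → Σ ℕ λ m → Prime p × (1 ≤ m × q ≡ p ^ m)

-- Division that returns 0 on a zero divisor (never used that way: for q ≥ 2
-- all denominators below are positive).
_div_ : ℕ → ℕ → ℕ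
m div zero = 0
m div suc d = m / suc d

numProd : ℕ → ℕ → ℕ → ℕ
numProd q a zero = 1
numProd q a (suc b) = numProd q a b * (q ^ (a ∸ b) ∸ 1)

denProd : ℕ → ℕ → ℕ
denProd q zero = 1
denProd q (suc b) = denProd q b * (q ^ suc b ∸ 1)

-- Gaussian binomial [a brack b]_q = ∏_{0≤i<b} (q^{a-i}-1)/(q^{b-i}-1)
-- (an integer; the quotient is exact). For b = 0 it is 1.
gauss : ℕ → ℕ → ℕ → ℕ
gauss q a b = numProd q a b div denProd q b

f₂ : ℕ → ℕ → ℕ → ℕ → ℕ → ℕ → ℕ
f₂ q n k t s x =
  gauss q (x ∸ t) 1 * gauss q (n ∸ t ∸ 1) (k ∸ t ∸ 1)
  + q ^ (2 * (x ∸ t)) * (gauss q (k + 1 ∸ x) 1 * gauss q (k + 1 ∸ x) 1)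
      * gauss q (n ∸ t ∸ 2) (k ∸ t ∸ 2)
  + 2 * s

g₁ : ℕ → ℕ → ℕ → ℕ → ℕ → ℤ
g₁ q n k t s =
  (+ gauss q (n ∸ t) (k ∸ t)
     ℤ.- + (q ^ ((k ∸ t) * (k + 1 ∸ t)) * gauss q (n ∸ k ∸ 1) (k ∸ t))
     ℤ.+ + s)
  ℤ.* + (gauss q (n ∸ t) (k ∸ t) + (s ⊓ (q ^ (k ∸ t + 1) * gauss q t 1)))

{-# OPTIONS --safe #-}
-- Write m = k − t, A = [n−t−1, m−1], B = [n−t−2, m−2], N = [n−t, m] and C = [n−k−1, m], where
-- [a,b] = gauss q a b (also in lemma names). The Gaussian binomials satisfy both Pascal rules, hence
-- q^(a−b) [a,b] ≤ [a+1,b+1]: N ≥ q^(n−k) A and A ≥ q^(n−k) B, and n − k ≥ 2m + 6 + log_q(13 s), so B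
-- is negligible against A.
-- (i) Raising x adds at least A to the first summand of f₂, while the second summand is at most
-- q^(2(m+1)) B < A.
-- (ii) Unrolling Pascal's rule m + 1 times gives N = D + q^(m(m+1)) C, and an induction along the
-- unrolling shows [m+1,1] A ≤ D + q^(m+1) [m+1,1] B. Hence 2 f₂(k) < D while the second factor is
-- below 2N, so the product is below D N ≤ g₁.
module Submission where

open import Defs
open import Data.Nat using (ℕ; zero; suc; _+_; _*_; _∸_; _^_; _≤_; _<_; z≤n; s≤s; _⊓_;
                            NonZero; >-nonZero; NonTrivial; nonTrivial⇒n>1)
open import Data.Nat.Properties
open import Data.Nat.DivMod using (m*n/n≡m)
open import Data.Nat.Primality using (Prime; prime⇒nonZero; prime⇒nonTrivial)
open import Data.Nat.Tactic.RingSolver using (solve-∀)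
open import Data.Integer as ℤ using (+_)
import Data.Integer.Properties as ℤP
open import Data.Product using (_,_; _×_)
open import Algebra.Properties.CommutativeSemigroup *-commutativeSemigroup using (xy∙z≈xz∙y; xy∙z≈x∙zy)
open import Relation.Binary.PropositionalEquality
open import Relation.Nullary using (yes; no)

[m∸n]+[o∸m]≡o∸n : ∀ {m n o} → n ≤ m → m ≤ o → (m ∸ n) + (o ∸ m) ≡ o ∸ n
[m∸n]+[o∸m]≡o∸n {m} {n} {o} n≤m m≤o = begin
  (m ∸ n) + (o ∸ m)   ≡⟨ +-comm (m ∸ n) (o ∸ m) ⟩
  (o ∸ m) + (m ∸ n)   ≡⟨ +-∸-assoc (o ∸ m) n≤m ⟨
  ((o ∸ m) + m) ∸ n   ≡⟨ cong (_∸ n) (m∸n+n≡m m≤o) ⟩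
  o ∸ n               ∎
  where open ≡-Reasoning

m≡n+o⇒m∸n≡o : ∀ {m} n {o} → m ≡ n + o → m ∸ n ≡ o
m≡n+o⇒m∸n≡o n {o} refl = m+n∸m≡n n o

[2+[c+a]]∸c≡2+a : ∀ c a → 2 + (c + a) ∸ c ≡ 2 + a
[2+[c+a]]∸c≡2+a c a = m≡n+o⇒m∸n≡o c (sym (trans (+-suc c (suc a)) (cong suc (+-suc c a))))

1≤n⇒m≤n*m : ∀ m {n} → 1 ≤ n → m ≤ n * m
1≤n⇒m≤n*m m 1≤n = ≤-trans (≤-reflexive (sym (*-identityˡ m))) (*-monoˡ-≤ m 1≤n)

1≤n⇒m≤m*n : ∀ m {n} → 1 ≤ n → m ≤ m * n
1≤n⇒m≤m*n m 1≤n = ≤-trans (≤-reflexive (sym (*-identityʳ m))) (*-monoʳ-≤ m 1≤n)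

x[P∸1]≡y[Q∸1] : ∀ x y P Q → x + Q * y ≡ P * x + y → x * (P ∸ 1) ≡ y * (Q ∸ 1)
x[P∸1]≡y[Q∸1] x y P Q eq = begin
  x * (P ∸ 1)             ≡⟨ *-distribˡ-∸ x P 1 ⟩
  x * P ∸ x * 1           ≡⟨ cong₂ _∸_ (*-comm x P) (*-identityʳ x) ⟩
  P * x ∸ x               ≡⟨ [m+n]∸[m+o]≡n∸o y (P * x) x ⟨
  (y + P * x) ∸ (y + x)   ≡⟨ cong₂ _∸_ (trans (+-comm y (P * x)) (sym eq)) (+-comm y x) ⟩
  (x + Q * y) ∸ (x + y)   ≡⟨ [m+n]∸[m+o]≡n∸o x (Q * y) y ⟩
  Q * y ∸ y               ≡⟨ cong₂ _∸_ (*-comm y Q) (*-identityʳ y) ⟨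
  y * Q ∸ y * 1           ≡⟨ *-distribˡ-∸ y Q 1 ⟨
  y * (Q ∸ 1)             ∎
  where open ≡-Reasoning

m*n-div-n≡m : ∀ m {n} → 1 ≤ n → (m * n) div n ≡ m
m*n-div-n≡m m {suc n} _ = m*n/n≡m m (suc n)

2≤p^r : ∀ {p r} → Prime p → 1 ≤ r → 2 ≤ p ^ r
2≤p^r {p} p-prime 1≤r = ≤-trans (subst (2 ≤_) (sym (*-identityʳ p)) (nonTrivial⇒n>1 p)) (^-monoʳ-≤ p 1≤r)
  where
  instance
    p-nonTrivial : NonTrivial p
    p-nonTrivial = prime⇒nonTrivial p-prime
    p≢0 : NonZero p
    p≢0 = prime⇒nonZero p-prime

F*[N+E+s]<[D+s]*[N+μ] : ∀ F E N D s μ → E + s < N → 2 * F < D → F * (N + E + s) < (D + s) * (N + μ)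
F*[N+E+s]<[D+s]*[N+μ] F E N D s μ E+s<N 2F<D = begin-strict
  F * (N + E + s)    ≡⟨ cong (F *_) (+-assoc N E s) ⟩
  F * (N + (E + s))  ≤⟨ *-monoʳ-≤ F (+-monoʳ-≤ N (<⇒≤ E+s<N)) ⟩
  F * (N + N)        ≡⟨ double F N ⟩
  2 * F * N          <⟨ *-monoˡ-< N 2F<D ⟩
  D * N              ≤⟨ *-mono-≤ (m≤m+n D s) (m≤m+n N μ) ⟩
  (D + s) * (N + μ)  ∎
  where
  open ≤-Reasoning
  instance
    N≢0 : NonZero N
    N≢0 = >-nonZero (≤-<-trans z≤n E+s<N)
  double : ∀ F N → F * (N + N) ≡ 2 * F * N
  double = solve-∀

2*F<D : ∀ {q g A Z s D W B} → 2 ≤ q → W * B + 2 * Z + 4 * s < A → (1 + q * g) * A ≤ D + W * B →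
        2 * (g * A + Z + 2 * s) < D
2*F<D {q} {g} {A} {Z} {s} {D} {W} {B} q≥2 small lower = +-cancelˡ-< (W * B) _ D (begin-strict
  W * B + 2 * (g * A + Z + 2 * s)       ≡⟨ regroup W B g A Z s ⟩
  (W * B + 2 * Z + 4 * s) + 2 * g * A   <⟨ +-monoˡ-< (2 * g * A) small ⟩
  A + 2 * g * A                         ≤⟨ +-monoʳ-≤ A (*-monoˡ-≤ A (*-monoˡ-≤ g q≥2)) ⟩
  A + q * g * A                         ≡⟨ expand q g A ⟨
  (1 + q * g) * A                       ≤⟨ lower ⟩
  D + W * B                             ≡⟨ +-comm D (W * B) ⟩
  W * B + D                             ∎)
  where
  open ≤-Reasoning
  regroup : ∀ W B g A Z s → W * B + 2 * (g * A + Z + 2 * s) ≡ (W * B + 2 * Z + 4 * s) + 2 * g * A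
  regroup = solve-∀
  expand : ∀ q g A → (1 + q * g) * A ≡ A + q * g * A
  expand = solve-∀

+L<[+N-+Y++s]*+Z : ∀ {L N D Y s Z} → N ≡ D + Y → L < (D + s) * Z →
                   + L ℤ.< (+ N ℤ.- + Y ℤ.+ + s) ℤ.* + Z
+L<[+N-+Y++s]*+Z {L} {_} {D} {Y} {s} {Z} refl L< = subst (+ L ℤ.<_) (sym +-form) (ℤ.+<+ L<)
  where
  open ≡-Reasoning
  +-form : (+ (D + Y) ℤ.- + Y ℤ.+ + s) ℤ.* + Z ≡ + ((D + s) * Z)
  +-form = begin
    (+ (D + Y) ℤ.- + Y ℤ.+ + s) ℤ.* + Z
      ≡⟨ cong (λ x → (x ℤ.+ + s) ℤ.* + Z) (trans (ℤP.m-n≡m⊖n (D + Y) Y) (ℤP.⊖-≥ (m≤n+m Y D))) ⟩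
    (+ (D + Y ∸ Y) ℤ.+ + s) ℤ.* + Z   ≡⟨ cong (λ x → (+ x ℤ.+ + s) ℤ.* + Z) (m+n∸n≡m D Y) ⟩
    (+ D ℤ.+ + s) ℤ.* + Z             ≡⟨ cong (ℤ._* + Z) (ℤP.pos-+ D s) ⟨
    + (D + s) ℤ.* + Z                 ≡⟨ ℤP.pos-* (D + s) Z ⟨
    + ((D + s) * Z)                   ∎

module _ (q : ℕ) where

  qbinom : ℕ → ℕ → ℕ
  qbinom a       zero    = 1
  qbinom zero    (suc b) = 0
  qbinom (suc a) (suc b) = qbinom a b + q ^ suc b * qbinom a (suc b)

  qbinom-above : ∀ {a b} → a < b → qbinom a b ≡ 0
  qbinom-above {zero}  {suc b} _ = refl
  qbinom-above {suc a} {suc b} (s≤s a<b)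
    rewrite qbinom-above a<b | qbinom-above (m<n⇒m<1+n a<b) = *-zeroʳ (q ^ suc b)

  -- Both sides are q^(a+1) [a,b+1] when b < a; otherwise [a,b+1] = 0.
  private
    exchange : ∀ a b → q ^ suc (suc b) * (q ^ (a ∸ suc b) * qbinom a (suc b))
                     ≡ q ^ (a ∸ b) * (q ^ suc b * qbinom a (suc b))
    exchange a b with b <? a
    ... | no b≮a rewrite qbinom-above (s≤s (≮⇒≥ b≮a)) =
      vanish (q ^ suc (suc b)) (q ^ (a ∸ suc b)) (q ^ (a ∸ b)) (q ^ suc b)
      where
      vanish : ∀ X Y Z W → X * (Y * 0) ≡ Z * (W * 0)
      vanish = solve-∀
    ... | yes b<a rewrite +-∸-assoc 1 b<a = swap q (q ^ b) (q ^ (a ∸ suc b)) (qbinom a (suc b))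
      where
      swap : ∀ q Qb Qd y → q * (q * Qb) * (Qd * y) ≡ q * Qd * (q * Qb * y)
      swap = solve-∀

  qbinom-pascal′ : ∀ a b → qbinom (suc a) (suc b) ≡ q ^ (a ∸ b) * qbinom a b + qbinom a (suc b)
  qbinom-pascal′ zero    zero    = cong suc (*-zeroʳ (q ^ 1))
  qbinom-pascal′ zero    (suc b) = *-zeroʳ (q ^ suc (suc b))
  qbinom-pascal′ (suc a) zero    = begin
    1 + q ^ 1 * qbinom (suc a) 1             ≡⟨ cong (λ y → 1 + q ^ 1 * y) (qbinom-pascal′ a zero) ⟩
    1 + q ^ 1 * (q ^ a * 1 + qbinom a 1)     ≡⟨ regroup q (q ^ a) (qbinom a 1) ⟩
    q ^ suc a * 1 + qbinom (suc a) 1         ∎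
    where
    open ≡-Reasoning
    regroup : ∀ q Qa y → 1 + q * 1 * (Qa * 1 + y) ≡ q * Qa * 1 + (1 + q * 1 * y)
    regroup = solve-∀
  qbinom-pascal′ (suc a) (suc b) = begin
    qbinom (suc a) (suc b) + Q₂ * qbinom (suc a) (suc (suc b))
      ≡⟨ cong₂ (λ u v → u + Q₂ * v) (qbinom-pascal′ a b) (qbinom-pascal′ a (suc b)) ⟩
    (P * x + y) + Q₂ * (P′ * y + z)    ≡⟨ expand P x y Q₂ P′ z ⟩
    P * x + y + Q₂ * (P′ * y) + Q₂ * z  ≡⟨ cong (λ w → P * x + y + w + Q₂ * z) (exchange a b) ⟩
    P * x + y + P * (Q₁ * y) + Q₂ * z   ≡⟨ collect P x y Q₁ Q₂ z ⟩
    P * (x + Q₁ * y) + (y + Q₂ * z)     ∎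
    where
    open ≡-Reasoning
    P P′ Q₁ Q₂ x y z : ℕ
    P = q ^ (a ∸ b)
    P′ = q ^ (a ∸ suc b)
    Q₁ = q ^ suc b
    Q₂ = q ^ suc (suc b)
    x = qbinom a b
    y = qbinom a (suc b)
    z = qbinom a (suc (suc b))
    expand : ∀ P x y Q₂ P′ z → (P * x + y) + Q₂ * (P′ * y + z) ≡ P * x + y + Q₂ * (P′ * y) + Q₂ * z
    expand = solve-∀
    collect : ∀ P x y Q₁ Q₂ z → P * x + y + P * (Q₁ * y) + Q₂ * z ≡ P * (x + Q₁ * y) + (y + Q₂ * z)
    collect = solve-∀

  qbinom-ratio : ∀ a b → qbinom a b * (q ^ (a ∸ b) ∸ 1) ≡ qbinom a (suc b) * (q ^ suc b ∸ 1)
  qbinom-ratio a b = x[P∸1]≡y[Q∸1] (qbinom a b) (qbinom a (suc b)) (q ^ (a ∸ b)) (q ^ suc b)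
                       (qbinom-pascal′ a b)

  numProd≡qbinom*denProd : ∀ a b → numProd q a b ≡ qbinom a b * denProd q b
  numProd≡qbinom*denProd a zero    = refl
  numProd≡qbinom*denProd a (suc b) = begin
    numProd q a b * (q ^ (a ∸ b) ∸ 1)          ≡⟨ cong (_* (q ^ (a ∸ b) ∸ 1)) (numProd≡qbinom*denProd a b) ⟩
    qbinom a b * d * (q ^ (a ∸ b) ∸ 1)         ≡⟨ xy∙z≈xz∙y (qbinom a b) d _ ⟩
    qbinom a b * (q ^ (a ∸ b) ∸ 1) * d         ≡⟨ cong (_* d) (qbinom-ratio a b) ⟩
    qbinom a (suc b) * (q ^ suc b ∸ 1) * d     ≡⟨ xy∙z≈x∙zy (qbinom a (suc b)) _ d ⟩
    qbinom a (suc b) * (d * (q ^ suc b ∸ 1))   ∎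
    where
    open ≡-Reasoning
    d : ℕ
    d = denProd q b

-- pascalSum q b a j = Σ_{i<j} q^((b+1)i) [a+j-i, b]: what j Pascal steps peel off [a+j+1, b+1].
pascalSum : ℕ → ℕ → ℕ → ℕ → ℕ
pascalSum q b a zero    = 0
pascalSum q b a (suc j) = gauss q (suc (j + a)) b + q ^ suc b * pascalSum q b a j

-- The induction step of pascalSum-lower, for g = [r+1,1], T = [r+a+1,c+1], B = [r+a,c],
-- S = pascalSum q (c+1) a (r+1), P = q^(r+1) and Qc = q^c; primes mark the values at r + 1.
pascalSum-lower-step : ∀ {q Qc P g g′ T T′ S B B′} → g′ ≡ 1 + q * g → T′ ≡ B′ + q * Qc * T →
  g * T ≤ S + P * g * B → Qc * B ≤ B′ → g ≤ P → g′ * T′ ≤ (T′ + q * (q * Qc) * S) + q * P * g′ * B′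
pascalSum-lower-step {q} {Qc} {P} {g} {T = T} {S = S} {B} {B′} refl refl gT≤ QcB≤B′ g≤P = begin
  (1 + q * g) * T′
    ≡⟨ expand q Qc g T B′ ⟩
  T′ + q * g * B′ + q * (q * Qc) * (g * T)
    ≤⟨ +-monoʳ-≤ (T′ + q * g * B′) (*-monoʳ-≤ (q * (q * Qc)) gT≤) ⟩
  T′ + q * g * B′ + q * (q * Qc) * (S + P * g * B)
    ≡⟨ regroup q Qc P g S B T′ B′ ⟩
  (T′ + q * (q * Qc) * S) + q * g * B′ + q * q * P * g * (Qc * B)
    ≤⟨ +-monoʳ-≤ (T′ + q * (q * Qc) * S + q * g * B′) (*-monoʳ-≤ (q * q * P * g) QcB≤B′) ⟩
  (T′ + q * (q * Qc) * S) + q * g * B′ + q * q * P * g * B′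
    ≤⟨ +-monoˡ-≤ (q * q * P * g * B′) (+-monoʳ-≤ (T′ + q * (q * Qc) * S) (*-monoˡ-≤ B′ (*-monoʳ-≤ q g≤P))) ⟩
  (T′ + q * (q * Qc) * S) + q * P * B′ + q * q * P * g * B′
    ≡⟨ collect q P g B′ (T′ + q * (q * Qc) * S) ⟩
  (T′ + q * (q * Qc) * S) + q * P * (1 + q * g) * B′ ∎
  where
  open ≤-Reasoning
  T′ : ℕ
  T′ = B′ + q * Qc * T
  expand : ∀ q Qc g T B′ → (1 + q * g) * (B′ + q * Qc * T)
         ≡ (B′ + q * Qc * T) + q * g * B′ + q * (q * Qc) * (g * T)
  expand = solve-∀
  regroup : ∀ q Qc P g S B T′ B′ → T′ + q * g * B′ + q * (q * Qc) * (S + P * g * B)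
          ≡ (T′ + q * (q * Qc) * S) + q * g * B′ + q * q * P * g * (Qc * B)
  regroup = solve-∀
  collect : ∀ q P g B′ X → X + q * P * B′ + q * q * P * g * B′ ≡ X + q * P * (1 + q * g) * B′
  collect = solve-∀

module _ {q : ℕ} (q≥2 : 2 ≤ q) where

  private instance
    q≢0 : NonZero q
    q≢0 = >-nonZero (<⇒≤ q≥2)

  denProd-positive : ∀ b → 1 ≤ denProd q b
  denProd-positive zero    = ≤-refl
  denProd-positive (suc b) = *-mono-≤ (denProd-positive b) (∸-monoˡ-≤ 1 (*-mono-≤ q≥2 (m^n>0 q b)))

  gauss≡qbinom : ∀ a b → gauss q a b ≡ qbinom q a b
  gauss≡qbinom a b =
    trans (cong (_div denProd q b) (numProd≡qbinom*denProd q a b)) (m*n-div-n≡m _ (denProd-positive b))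

  gauss-pascal : ∀ a b → gauss q (suc a) (suc b) ≡ gauss q a b + q ^ suc b * gauss q a (suc b)
  gauss-pascal a b rewrite gauss≡qbinom (suc a) (suc b) | gauss≡qbinom a b | gauss≡qbinom a (suc b) = refl

  gauss-pascal′ : ∀ a b → gauss q (suc a) (suc b) ≡ q ^ (a ∸ b) * gauss q a b + gauss q a (suc b)
  gauss-pascal′ a b rewrite gauss≡qbinom (suc a) (suc b) | gauss≡qbinom a b | gauss≡qbinom a (suc b) =
    qbinom-pascal′ q a b

  gauss-positive : ∀ {a b} → b ≤ a → 1 ≤ gauss q a b
  gauss-positive {a}     {zero}  _         = ≤-refl
  gauss-positive {suc a} {suc b} (s≤s b≤a) rewrite gauss-pascal a b = ≤-trans (gauss-positive b≤a) (m≤m+n _ _)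

  [1+i,1]≡1+q[i,1] : ∀ i → gauss q (suc i) 1 ≡ 1 + q * gauss q i 1
  [1+i,1]≡1+q[i,1] i rewrite gauss-pascal i 0 | *-identityʳ q = refl

  [1,1]≡1 : gauss q 1 1 ≡ 1
  [1,1]≡1 rewrite [1+i,1]≡1+q[i,1] 0 | gauss≡qbinom 0 1 | *-zeroʳ q = refl

  [i,1]<q^i : ∀ i → gauss q i 1 < q ^ i
  [i,1]<q^i zero rewrite gauss≡qbinom 0 1 = ≤-refl
  [i,1]<q^i (suc i) rewrite [1+i,1]≡1+q[i,1] i = begin-strict
    1 + q * g   <⟨ +-monoˡ-< (q * g) q≥2 ⟩
    q + q * g   ≡⟨ *-suc q g ⟨
    q * suc g   ≤⟨ *-monoʳ-≤ q ([i,1]<q^i i) ⟩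
    q * q ^ i   ∎
    where
    open ≤-Reasoning
    g : ℕ
    g = gauss q i 1

  q^c*[a,c]≤[1+a,c] : ∀ a c → q ^ c * gauss q a c ≤ gauss q (suc a) c
  q^c*[a,c]≤[1+a,c] a zero    = ≤-refl
  q^c*[a,c]≤[1+a,c] a (suc c) rewrite gauss-pascal a c = m≤n+m _ _

  q^[a∸b]*[a,b]≤[1+a,1+b] : ∀ a b → q ^ (a ∸ b) * gauss q a b ≤ gauss q (suc a) (suc b)
  q^[a∸b]*[a,b]≤[1+a,1+b] a b rewrite gauss-pascal′ a b = m≤m+n _ _

  gauss-pascal-iterated : ∀ b a j →
    gauss q (suc (j + a)) (suc b) ≡ pascalSum q b a j + q ^ (j * suc b) * gauss q (suc a) (suc b)
  gauss-pascal-iterated b a zero    = sym (+-identityʳ _)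
  gauss-pascal-iterated b a (suc j) = begin
    gauss q (suc (suc (j + a))) (suc b)   ≡⟨ gauss-pascal (suc (j + a)) b ⟩
    T + Q * gauss q (suc (j + a)) (suc b) ≡⟨ cong (λ x → T + Q * x) (gauss-pascal-iterated b a j) ⟩
    T + Q * (S + P * G)                   ≡⟨ distrib T Q S P G ⟩
    (T + Q * S) + Q * P * G
      ≡⟨ cong (λ x → (T + Q * S) + x * G) (^-distribˡ-+-* q (suc b) (j * suc b)) ⟨
    (T + Q * S) + q ^ (suc b + j * suc b) * G ∎
    where
    open ≡-Reasoning
    T Q S P G : ℕ
    T = gauss q (suc (j + a)) b
    Q = q ^ suc b
    S = pascalSum q b a j
    P = q ^ (j * suc b)
    G = gauss q (suc a) (suc b)
    distrib : ∀ T Q S P G → T + Q * (S + P * G) ≡ (T + Q * S) + Q * P * G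
    distrib = solve-∀

  pascalSum-lower : ∀ c a r → gauss q (suc r) 1 * gauss q (suc (r + a)) (suc c)
                    ≤ pascalSum q (suc c) a (suc r) + q ^ suc r * gauss q (suc r) 1 * gauss q (r + a) c
  pascalSum-lower c a zero rewrite [1,1]≡1 =
    ≤-trans (≤-reflexive (*-identityˡ _)) (≤-trans (m≤m+n _ _) (m≤m+n _ _))
  pascalSum-lower c a (suc r) =
    pascalSum-lower-step {q} {q ^ c} ([1+i,1]≡1+q[i,1] (suc r)) (gauss-pascal (suc (r + a)) c)
      (pascalSum-lower c a r) (q^c*[a,c]≤[1+a,c] (r + a) c) (<⇒≤ ([i,1]<q^i (suc r)))

  q^i*[q^j*x]≡q^[i+j]*x : ∀ i j x → q ^ i * (q ^ j * x) ≡ q ^ (i + j) * x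
  q^i*[q^j*x]≡q^[i+j]*x i j x =
    trans (sym (*-assoc (q ^ i) (q ^ j) x)) (cong (_* x) (sym (^-distribˡ-+-* q i j)))

  q^x*q^x≡q^[2*x] : ∀ x → q ^ x * q ^ x ≡ q ^ (2 * x)
  q^x*q^x≡q^[2*x] x = trans (sym (^-distribˡ-+-* q x x)) (cong (λ y → q ^ (x + y)) (sym (+-identityʳ x)))

  q^[2i]*[h,1]²≤q^[2[i+h]] : ∀ i h → q ^ (2 * i) * (gauss q h 1 * gauss q h 1) ≤ q ^ (2 * (i + h))
  q^[2i]*[h,1]²≤q^[2[i+h]] i h = begin
    q ^ (2 * i) * (gauss q h 1 * gauss q h 1)
      ≤⟨ *-monoʳ-≤ (q ^ (2 * i)) (*-mono-≤ (<⇒≤ ([i,1]<q^i h)) (<⇒≤ ([i,1]<q^i h))) ⟩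
    q ^ (2 * i) * (q ^ h * q ^ h)   ≡⟨ cong (q ^ (2 * i) *_) (q^x*q^x≡q^[2*x] h) ⟩
    q ^ (2 * i) * q ^ (2 * h)       ≡⟨ ^-distribˡ-+-* q (2 * i) (2 * h) ⟨
    q ^ (2 * i + 2 * h)             ≡⟨ cong (q ^_) (*-distribˡ-+ 2 i h) ⟨
    q ^ (2 * (i + h))               ∎
    where open ≤-Reasoning

  f₂-step : ∀ n k t s x → t ≤ x → x ≤ k + 1 →
    q ^ (2 * (k + 1 ∸ t)) * gauss q (n ∸ t ∸ 2) (k ∸ t ∸ 2) < gauss q (n ∸ t ∸ 1) (k ∸ t ∸ 1) →
    f₂ q n k t s x < f₂ q n k t s (x + 1)
  f₂-step n k t s x t≤x x≤k+1 B-term<A = begin-strict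
    [ i ]₁ * A + q ^ (2 * i) * ([ h ]₁ * [ h ]₁) * B + 2 * s
      <⟨ +-monoˡ-< (2 * s) (+-monoʳ-< ([ i ]₁ * A)
                             (≤-<-trans (*-monoˡ-≤ B q^[2i]*[h,1]²≤q^[2[k+1∸t]]) B-term<A)) ⟩
    [ i ]₁ * A + A + 2 * s
      ≤⟨ +-monoˡ-≤ (2 * s) (≤-trans (≤-reflexive (+-comm ([ i ]₁ * A) A))
                                    (+-monoʳ-≤ A (*-monoˡ-≤ A (1≤n⇒m≤n*m [ i ]₁ (<⇒≤ q≥2))))) ⟩
    (1 + q * [ i ]₁) * A + 2 * s
      ≡⟨ cong (λ g → g * A + 2 * s) (trans (cong [_]₁ x+1∸t≡1+i) ([1+i,1]≡1+q[i,1] i)) ⟨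
    [ x + 1 ∸ t ]₁ * A + 2 * s
      ≤⟨ +-monoˡ-≤ (2 * s) (m≤m+n ([ x + 1 ∸ t ]₁ * A) _) ⟩
    f₂ q n k t s (x + 1) ∎
    where
    open ≤-Reasoning
    [_]₁ : ℕ → ℕ
    [ j ]₁ = gauss q j 1
    i h A B : ℕ
    i = x ∸ t
    h = k + 1 ∸ x
    A = gauss q (n ∸ t ∸ 1) (k ∸ t ∸ 1)
    B = gauss q (n ∸ t ∸ 2) (k ∸ t ∸ 2)
    x+1∸t≡1+i : x + 1 ∸ t ≡ suc i
    x+1∸t≡1+i = trans (+-∸-comm 1 t≤x) (+-comm i 1)
    q^[2i]*[h,1]²≤q^[2[k+1∸t]] : q ^ (2 * i) * ([ h ]₁ * [ h ]₁) ≤ q ^ (2 * (k + 1 ∸ t))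
    q^[2i]*[h,1]²≤q^[2[k+1∸t]] =
      subst (λ y → q ^ (2 * i) * ([ h ]₁ * [ h ]₁) ≤ q ^ (2 * y)) ([m∸n]+[o∸m]≡o∸n t≤x x≤k+1)
        (q^[2i]*[h,1]²≤q^[2[i+h]] i h)

  -- With k ∸ t = 2 + c and n ∸ k = 2 + a: A = [n-t-1, k-t-1], B = [n-t-2, k-t-2], N = [n-t, k-t],
  -- C = [n-k-1, k-t], and N = D + q^((k-t)(k+1-t)) C.
  module Binomials (c a : ℕ) where

    A B N C D : ℕ
    A = gauss q (3 + (c + a)) (suc c)
    B = gauss q (2 + (c + a)) c
    N = gauss q (4 + (c + a)) (2 + c)
    C = gauss q (suc a) (2 + c)
    D = pascalSum q (suc c) a (3 + c)

    N≡D+q^[[2+c]*[3+c]]*C : N ≡ D + q ^ ((2 + c) * (3 + c)) * C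
    N≡D+q^[[2+c]*[3+c]]*C =
      trans (gauss-pascal-iterated (suc c) a (3 + c)) (cong (λ x → D + q ^ x * C) (*-comm (3 + c) (2 + c)))

    q^[2+a]*B≤A : q ^ (2 + a) * B ≤ A
    q^[2+a]*B≤A =
      subst (λ d → q ^ d * B ≤ A) ([2+[c+a]]∸c≡2+a c a)
        (q^[a∸b]*[a,b]≤[1+a,1+b] (2 + (c + a)) c)

    q^[2+a]*A≤N : q ^ (2 + a) * A ≤ N
    q^[2+a]*A≤N =
      subst (λ d → q ^ d * A ≤ N) ([2+[c+a]]∸c≡2+a c a)
        (q^[a∸b]*[a,b]≤[1+a,1+b] (3 + (c + a)) (suc c))

    B-positive : 1 ≤ B
    B-positive = gauss-positive (≤-trans (m≤m+n c a) (m≤n+m (c + a) 2))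

    A-positive : 1 ≤ A
    A-positive = gauss-positive (s≤s (≤-trans (m≤m+n c a) (m≤n+m (c + a) 2)))

    D-lower-bound : (1 + q * gauss q (2 + c) 1) * A ≤ D + q ^ (3 + c) * gauss q (3 + c) 1 * B
    D-lower-bound = subst (λ g → g * A ≤ D + q ^ (3 + c) * gauss q (3 + c) 1 * B) ([1+i,1]≡1+q[i,1] (2 + c))
        (pascalSum-lower c a (2 + c))

    A-dominance : ∀ e → e + 2 * (3 + c) ≤ a → 4 * (q ^ e * (q ^ (2 * (3 + c)) * B)) ≤ A
    A-dominance e exponent = begin
      4 * (q ^ e * (q ^ x * B))     ≤⟨ *-monoˡ-≤ _ (^-monoˡ-≤ 2 q≥2) ⟩
      q ^ 2 * (q ^ e * (q ^ x * B)) ≡⟨ cong (q ^ 2 *_) (q^i*[q^j*x]≡q^[i+j]*x e x B) ⟩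
      q ^ 2 * (q ^ (e + x) * B)     ≡⟨ q^i*[q^j*x]≡q^[i+j]*x 2 (e + x) B ⟩
      q ^ (2 + (e + x)) * B         ≤⟨ *-monoˡ-≤ B (^-monoʳ-≤ q (+-monoʳ-≤ 2 exponent)) ⟩
      q ^ (2 + a) * B               ≤⟨ q^[2+a]*B≤A ⟩
      A                             ∎
      where
      open ≤-Reasoning
      x : ℕ
      x = 2 * (3 + c)

    N-dominance : ∀ e r → e + r ≤ suc a → 2 * (q ^ e * (q ^ r * A)) ≤ N
    N-dominance e r exponent = begin
      2 * (q ^ e * (q ^ r * A))     ≤⟨ *-monoˡ-≤ _ q≥2 ⟩
      q * (q ^ e * (q ^ r * A))     ≡⟨ cong (q *_) (q^i*[q^j*x]≡q^[i+j]*x e r A) ⟩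
      q * (q ^ (e + r) * A)         ≡⟨ *-assoc q _ A ⟨
      q ^ suc (e + r) * A           ≤⟨ *-monoˡ-≤ A (^-monoʳ-≤ q (s≤s exponent)) ⟩
      q ^ (2 + a) * A               ≤⟨ q^[2+a]*A≤N ⟩
      N                             ∎
      where open ≤-Reasoning

    q^[2[3+c]]*B<A : ∀ e → e + 2 * (3 + c) ≤ a → q ^ (2 * (3 + c)) * B < A
    q^[2[3+c]]*B<A e exponent = begin-strict
      X          ≤⟨ 1≤n⇒m≤n*m X (m^n>0 q e) ⟩
      Y          <⟨ subst (Y <_) (*-comm Y 4) (m<m*n Y 4 (s≤s (s≤s z≤n))) ⟩
      4 * Y      ≤⟨ A-dominance e exponent ⟩
      A          ∎
      where
      open ≤-Reasoning
      X Y : ℕ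
      X = q ^ (2 * (3 + c)) * B
      Y = q ^ e * X
      instance
        Y≢0 : NonZero Y
        Y≢0 = >-nonZero (*-mono-≤ (m^n>0 q e) (*-mono-≤ (m^n>0 q (2 * (3 + c))) B-positive))

    error-terms<A : ∀ e s → 4 * s < q ^ e → e + 2 * (3 + c) ≤ a →
      q ^ (3 + c) * gauss q (3 + c) 1 * B + 2 * (q ^ (2 * (2 + c)) * (gauss q 1 1 * gauss q 1 1) * B) + 4 * s < A
    error-terms<A e s 4s<q^e exponent rewrite [1,1]≡1 = begin-strict
      W * B + 2 * (P * 1 * B) + 4 * s  ≤⟨ +-monoˡ-≤ (4 * s) (+-mono-≤ (*-monoˡ-≤ B W≤q^x) 2*P*1*B≤X) ⟩
      X + X + 4 * s                    <⟨ +-monoʳ-< (X + X) (<-≤-trans 4s<q^e (1≤n⇒m≤m*n (q ^ e) X-positive)) ⟩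
      X + X + q ^ e * X                ≤⟨ +-monoˡ-≤ (q ^ e * X) (+-mono-≤ X≤q^e*X X≤q^e*X) ⟩
      Y + Y + Y                        ≤⟨ subst (Y + Y + Y ≤_) (three+one Y) (m≤m+n (Y + Y + Y) Y) ⟩
      4 * Y                            ≤⟨ A-dominance e exponent ⟩
      A                                ∎
      where
      open ≤-Reasoning
      x P W X Y : ℕ
      x = 2 * (3 + c)
      P = q ^ (2 * (2 + c))
      W = q ^ (3 + c) * gauss q (3 + c) 1
      X = q ^ x * B
      Y = q ^ e * X
      X-positive : 1 ≤ X
      X-positive = *-mono-≤ (m^n>0 q x) B-positive
      X≤q^e*X : X ≤ Y
      X≤q^e*X = 1≤n⇒m≤n*m X (m^n>0 q e)
      W≤q^x : W ≤ q ^ x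
      W≤q^x =
        ≤-trans (*-monoʳ-≤ (q ^ (3 + c)) (<⇒≤ ([i,1]<q^i (3 + c)))) (≤-reflexive (q^x*q^x≡q^[2*x] (3 + c)))
      2*P*1*B≤X : 2 * (P * 1 * B) ≤ X
      2*P*1*B≤X = begin
        2 * (P * 1 * B)  ≡⟨ cong (λ y → 2 * (y * B)) (*-identityʳ P) ⟩
        2 * (P * B)      ≤⟨ *-monoˡ-≤ (P * B) q≥2 ⟩
        q * (P * B)      ≡⟨ *-assoc q P B ⟨
        q ^ suc (2 * (2 + c)) * B  ≤⟨ *-monoˡ-≤ B (^-monoʳ-≤ q (s≤s (+-monoʳ-≤ (2 + c) (n≤1+n _)))) ⟩
        X                ∎
      three+one : ∀ Y → Y + Y + Y + Y ≡ 4 * Y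
      three+one = solve-∀

    q²[2+c,1][t,1]A+s<N : ∀ e t s → s < q ^ e → e + (4 + (c + t)) ≤ suc a →
          q ^ 2 * gauss q (2 + c) 1 * gauss q t 1 * A + s < N
    q²[2+c,1][t,1]A+s<N e t s s<q^e exponent = begin-strict
      q ^ 2 * gauss q (2 + c) 1 * gauss q t 1 * A + s
        ≤⟨ +-monoˡ-≤ s (*-monoˡ-≤ A q²[2+c,1][t,1]≤R) ⟩
      R * A + s
        <⟨ +-monoʳ-< (R * A) s<q^e ⟩
      R * A + q ^ e
        ≤⟨ +-mono-≤ (1≤n⇒m≤n*m (R * A) (m^n>0 q e)) (1≤n⇒m≤m*n (q ^ e) RA-positive) ⟩
      q ^ e * (R * A) + q ^ e * (R * A)
        ≡⟨ cong (λ y → q ^ e * (R * A) + y) (+-identityʳ _) ⟨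
      2 * (q ^ e * (R * A))
        ≤⟨ N-dominance e (4 + (c + t)) exponent ⟩
      N ∎
      where
      open ≤-Reasoning
      R : ℕ
      R = q ^ (4 + (c + t))
      RA-positive : 1 ≤ R * A
      RA-positive = *-mono-≤ (m^n>0 q (4 + (c + t))) A-positive
      q²[2+c,1][t,1]≤R : q ^ 2 * gauss q (2 + c) 1 * gauss q t 1 ≤ R
      q²[2+c,1][t,1]≤R = begin
        q ^ 2 * gauss q (2 + c) 1 * gauss q t 1
          ≤⟨ *-mono-≤ (*-monoʳ-≤ (q ^ 2) (<⇒≤ ([i,1]<q^i (2 + c)))) (<⇒≤ ([i,1]<q^i t)) ⟩
        q ^ 2 * q ^ (2 + c) * q ^ t
          ≡⟨ trans (^-distribˡ-+-* q (2 + (2 + c)) t) (cong (_* q ^ t) (^-distribˡ-+-* q 2 (2 + c))) ⟨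
        R ∎

    product-bound : ∀ t e s → 1 ≤ s → 13 * s ≤ q ^ e → e + 2 * (3 + c) ≤ a → e + (4 + (c + t)) ≤ suc a →
      + ((gauss q (2 + c) 1 * A + q ^ (2 * (2 + c)) * (gauss q 1 1 * gauss q 1 1) * B + 2 * s)
         * (N + q ^ 2 * gauss q (2 + c) 1 * gauss q t 1 * A + s))
      ℤ.< (+ N ℤ.- + (q ^ ((2 + c) * (3 + c)) * C) ℤ.+ + s) ℤ.* + (N + (s ⊓ (q ^ (2 + c + 1) * gauss q t 1)))
    product-bound t e s 1≤s 13s≤q^e expA expN =
      +L<[+N-+Y++s]*+Z {Y = q ^ ((2 + c) * (3 + c)) * C} N≡D+q^[[2+c]*[3+c]]*C
        (F*[N+E+s]<[D+s]*[N+μ] F E N D s μ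
          (q²[2+c,1][t,1]A+s<N e t s (≤-<-trans (m≤n*m s 4) 4s<q^e) expN)
          (2*F<D {s = s} {W = q ^ (3 + c) * gauss q (3 + c) 1} {B = B} q≥2 (error-terms<A e s 4s<q^e expA)
            D-lower-bound))
      where
      F E μ : ℕ
      F = gauss q (2 + c) 1 * A + q ^ (2 * (2 + c)) * (gauss q 1 1 * gauss q 1 1) * B + 2 * s
      E = q ^ 2 * gauss q (2 + c) 1 * gauss q t 1 * A
      μ = s ⊓ (q ^ (2 + c + 1) * gauss q t 1)
      instance
        s≢0 : NonZero s
        s≢0 = >-nonZero 1≤s
      4s<q^e : 4 * s < q ^ e
      4s<q^e = <-≤-trans (*-monoˡ-< s {4} {13} (s≤s (s≤s (s≤s (s≤s (s≤s z≤n)))))) 13s≤q^e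

  -- The truncated differences k ∸ t, n ∸ t, n ∸ k, k + 1 ∸ t and k + 1 ∸ k of the theorem are
  -- abstracted as m, M, d, m⁺ and one, so that they can be substituted by pattern matching.
  f₂-B-term<A : ∀ {m M m⁺} c a e → m ≡ 2 + c → M ≡ 4 + (c + a) → m⁺ ≡ 3 + c → e + 2 * (3 + c) ≤ a →
                q ^ (2 * m⁺) * gauss q (M ∸ 2) (m ∸ 2) < gauss q (M ∸ 1) (m ∸ 1)
  f₂-B-term<A c a e refl refl refl = Binomials.q^[2[3+c]]*B<A c a e

  f₂[k]-product-bound : ∀ {t s m M d m⁺ one} c a e →
    m ≡ 2 + c → M ≡ 4 + (c + a) → d ≡ 2 + a → m⁺ ≡ 3 + c → one ≡ 1 →
    1 ≤ s → 13 * s ≤ q ^ e → e + 2 * (3 + c) ≤ a → e + (4 + (c + t)) ≤ suc a →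
    + ((gauss q m 1 * gauss q (M ∸ 1) (m ∸ 1)
        + q ^ (2 * m) * (gauss q one 1 * gauss q one 1) * gauss q (M ∸ 2) (m ∸ 2) + 2 * s)
       * (gauss q M m + q ^ 2 * gauss q m 1 * gauss q t 1 * gauss q (M ∸ 1) (m ∸ 1) + s))
    ℤ.< (+ gauss q M m ℤ.- + (q ^ (m * m⁺) * gauss q (d ∸ 1) m) ℤ.+ + s)
        ℤ.* + (gauss q M m + (s ⊓ (q ^ (m + 1) * gauss q t 1)))
  f₂[k]-product-bound {t} {s} c a e refl refl refl refl refl = Binomials.product-bound c a t e s

module Parameters (t₀ c e : ℕ) where

  t k n a : ℕ
  t = suc t₀
  k = t + 2 + c
  n = 3 * k + 3 * t + 1 + e
  a = 5 * t + 3 + 2 * c + e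

  k∸t≡2+c : k ∸ t ≡ 2 + c
  k∸t≡2+c = m≡n+o⇒m∸n≡o t (+-assoc t 2 c)

  k+1∸t≡3+c : k + 1 ∸ t ≡ 3 + c
  k+1∸t≡3+c = m≡n+o⇒m∸n≡o t (split t₀ c)
    where
    split : ∀ t₀ c → suc t₀ + 2 + c + 1 ≡ suc t₀ + (3 + c)
    split = solve-∀

  n∸t≡4+[c+a] : n ∸ t ≡ 4 + (c + a)
  n∸t≡4+[c+a] = m≡n+o⇒m∸n≡o t (split t₀ c e)
    where
    split : ∀ t₀ c e → 3 * (suc t₀ + 2 + c) + 3 * suc t₀ + 1 + e
                     ≡ suc t₀ + (4 + (c + (5 * suc t₀ + 3 + 2 * c + e)))
    split = solve-∀

  n∸k≡2+a : n ∸ k ≡ 2 + a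
  n∸k≡2+a = m≡n+o⇒m∸n≡o k (split t₀ c e)
    where
    split : ∀ t₀ c e → 3 * (suc t₀ + 2 + c) + 3 * suc t₀ + 1 + e
                     ≡ (suc t₀ + 2 + c) + (2 + (5 * suc t₀ + 3 + 2 * c + e))
    split = solve-∀

  exponent-A : e + 2 * (3 + c) ≤ a
  exponent-A = subst (e + 2 * (3 + c) ≤_) (gap t₀ c e) (m≤m+n _ (5 * t₀ + 2))
    where
    gap : ∀ t₀ c e → e + 2 * (3 + c) + (5 * t₀ + 2) ≡ 5 * suc t₀ + 3 + 2 * c + e
    gap = solve-∀

  exponent-N : e + (4 + (c + t)) ≤ suc a
  exponent-N = subst (e + (4 + (c + t)) ≤_) (gap t₀ c e) (m≤m+n _ (4 * t₀ + 4 + c))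
    where
    gap : ∀ t₀ c e → e + (4 + (c + suc t₀)) + (4 * t₀ + 4 + c) ≡ suc (5 * suc t₀ + 3 + 2 * c + e)
    gap = solve-∀

lemma2p7 : (q : ℕ) → IsPrimePower q → (n k t s : ℕ)
    → 1 ≤ n → 1 ≤ k → 1 ≤ t → 1 ≤ s
    → t + 2 ≤ k
    → 3 * k + 3 * t + 1 ≤ n
    → 13 * s ≤ q ^ (n ∸ (3 * k + 3 * t + 1))
    → ((x : ℕ) → t + 1 ≤ x → x + 1 ≤ k ∸ 1
         → f₂ q n k t s x < f₂ q n k t s (x + 1))
      × (+ (f₂ q n k t s k
             * (gauss q (n ∸ t) (k ∸ t)
                + q ^ 2 * gauss q (k ∸ t) 1 * gauss q t 1 * gauss q (n ∸ t ∸ 1) (k ∸ t ∸ 1)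
                + s))
         ℤ.< g₁ q n k t s)
lemma2p7 q (p , r , p-prime , 1≤r , q≡p^r) n k t s _ _ 1≤t 1≤s t+2≤k 3k+3t+1≤n 13s≤q^[n∸[3k+3t+1]]
  with m≤n⇒∃[o]m+o≡n 1≤t | m≤n⇒∃[o]m+o≡n t+2≤k | m≤n⇒∃[o]m+o≡n 3k+3t+1≤n
... | t₀ , refl | c , refl | e , refl = increasing , product
  where
  open Parameters t₀ c e using (a; k∸t≡2+c; k+1∸t≡3+c; n∸t≡4+[c+a]; n∸k≡2+a; exponent-A; exponent-N)
  q≥2 : 2 ≤ q
  q≥2 = subst (2 ≤_) (sym q≡p^r) (2≤p^r p-prime 1≤r)
  13s≤q^e : 13 * s ≤ q ^ e
  13s≤q^e = subst (λ y → 13 * s ≤ q ^ y) (m+n∸m≡n (3 * k + 3 * t + 1) e) 13s≤q^[n∸[3k+3t+1]]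
  increasing : (x : ℕ) → t + 1 ≤ x → x + 1 ≤ k ∸ 1 → f₂ q n k t s x < f₂ q n k t s (x + 1)
  increasing x t+1≤x x+1≤k∸1 =
    f₂-step q≥2 n k t s x (m+n≤o⇒m≤o t t+1≤x)
      (≤-trans (m+n≤o⇒m≤o x x+1≤k∸1) (≤-trans (m∸n≤m k 1) (m≤m+n k 1)))
      (f₂-B-term<A q≥2 c a e k∸t≡2+c n∸t≡4+[c+a] k+1∸t≡3+c exponent-A)
  product : + (f₂ q n k t s k * (gauss q (n ∸ t) (k ∸ t)
                                 + q ^ 2 * gauss q (k ∸ t) 1 * gauss q t 1 * gauss q (n ∸ t ∸ 1) (k ∸ t ∸ 1) + s))
            ℤ.< g₁ q n k t s
  product = f₂[k]-product-bound q≥2 c a e k∸t≡2+c n∸t≡4+[c+a] n∸k≡2+a k+1∸t≡3+c (m+n∸m≡n k 1)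
              1≤s 13s≤q^e exponent-A exponent-N
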